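{- Let $G$ be a finite simple graph that contains no induced subgraph isomorphic to $P_3\cup 2K_1$ and no induced subgraph isomorphic to $\overline{P_3\cup 2K_1}$, and suppose $\omega(G)\geq 4$. Let $A=\{v_1,\ldots,v_\omega\}$ be a maximum clique of $G$ ($\omega=\omega(G)$); for $k\in[\omega]$ let $I_k$ be the set of vertices of $V(G)\setminus A$ adjacent to every $v_i$ with $i\neq k$ but not to $v_k$; let $X_1=A\cup\bigcup_{k}I_k$ and $V_2=V(G)\setminus X_1$. Let $A'=\{v'_1,\ldots,v'_m\}$ be a maximum clique of the induced subgraph $\langle V_2\rangle$ (so $m=\omega(\langle V_2\rangle)$); for $k\in[m]$ let $I'_k$ be the set of vertices of $V_2\setminus A'$ adjacent to every $v'_i$ with $i\neq k$ but not to $v'_k$; let $X_2=A'\cup\bigcup_{k=1}^m I'_k$ and $X_3=V_2\setminus X_2$. Then $V(G)=X_1\cup X_2\cup X_3$, where $\langle X_1\rangle$ is a complete multipartite graph, $\langle X_2\rangle$ is a multipartite graph (and a complete multipartite graph if $\omega(\langle V_2\rangle)\geq 4$), and $\langle X_3\rangle$ is a disjoint union of cliques.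
   Context: $P_3\cup 2K_1$ denotes the disjoint union of a path on three vertices and two isolated vertices; $\overline{H}$ is the complement of $H$. $\omega(\cdot)$ is the clique number and $\langle S\rangle$ is the subgraph induced by $S$. $[k]=\{1,\ldots,k\}$. -}

module Defs where

open import Data.Nat using (ℕ; _≤_)
open import Data.Bool using (Bool; true; false; not; if_then_else_)
open import Data.Fin using (Fin; zero; suc; _≟_)
open import Data.Fin.Subset using (Subset; _∈_; _∉_; ∣_∣)
open import Data.Product using (Σ; _×_; ∃)
open import Data.Sum using (_⊎_)
open import Data.Unit using (⊤)
open import Function.Definitions using (Injective)
open import Relation.Nullary using (¬_)
open import Relation.Nullary.Decidable using (⌊_⌋)
open import Relation.Binary.PropositionalEquality using (_≡_; _≢_)

record Graph (n : ℕ) : Set where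
  field
    adj    : Fin n → Fin n → Bool
    sym    : ∀ i j → adj i j ≡ adj j i
    irrefl : ∀ i → adj i i ≡ false
open Graph public

complementAdj : {k : ℕ} → (Fin k → Fin k → Bool) → Fin k → Fin k → Bool
complementAdj h i j = if ⌊ i ≟ j ⌋ then false else not (h i j)

P3∪2K1 : Fin 5 → Fin 5 → Bool
P3∪2K1 zero (suc zero) = true
P3∪2K1 (suc zero) zero = true
P3∪2K1 (suc zero) (suc (suc zero)) = true
P3∪2K1 (suc (suc zero)) (suc zero) = true
P3∪2K1 _ _ = false

ContainsInduced : {n k : ℕ} → Graph n → (Fin k → Fin k → Bool) → Set
ContainsInduced {n} {k} G h =
  Σ (Fin k → Fin n) λ f → Injective _≡_ _≡_ f × (∀ i j → adj G (f i) (f j) ≡ h i j)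

VSet : ℕ → Set₁
VSet n = Fin n → Set

Everything : {n : ℕ} → VSet n
Everything _ = ⊤

_⊆ₚ_ : {n : ℕ} → Subset n → VSet n → Set
S ⊆ₚ P = ∀ x → x ∈ S → P x

IsClique : {n : ℕ} → Graph n → Subset n → Set
IsClique G S = ∀ i j → i ∈ S → j ∈ S → i ≢ j → adj G i j ≡ true

IsMaxCliqueIn : {n : ℕ} → Graph n → VSet n → Subset n → Set
IsMaxCliqueIn G W C =
  C ⊆ₚ W × IsClique G C × (∀ T → T ⊆ₚ W → IsClique G T → ∣ T ∣ ≤ ∣ C ∣)

Ipart : {n : ℕ} → Graph n → VSet n → Subset n → Fin n → VSet n
Ipart G W C k v =
  W v × v ∉ C × adj G v k ≡ false × (∀ i → i ∈ C → i ≢ k → adj G v i ≡ true)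

Xpart : {n : ℕ} → Graph n → VSet n → Subset n → VSet n
Xpart {n} G W C v = v ∈ C ⊎ Σ (Fin n) λ k → k ∈ C × Ipart G W C k v

X₁ : {n : ℕ} → Graph n → Subset n → VSet n
X₁ G A = Xpart G Everything A

V₂ : {n : ℕ} → Graph n → Subset n → VSet n
V₂ G A v = ¬ X₁ G A v

X₂ : {n : ℕ} → Graph n → Subset n → Subset n → VSet n
X₂ G A A' = Xpart G (V₂ G A) A'

X₃ : {n : ℕ} → Graph n → Subset n → Subset n → VSet n
X₃ G A A' v = V₂ G A v × ¬ X₂ G A A' v

IsMultipartite : {n : ℕ} → Graph n → VSet n → Set
IsMultipartite {n} G S = Σ (Fin n → ℕ) λ p →
  ∀ x y → S x → S y → x ≢ y → p x ≡ p y → adj G x y ≡ false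

IsCompleteMultipartite : {n : ℕ} → Graph n → VSet n → Set
IsCompleteMultipartite {n} G S = Σ (Fin n → ℕ) λ p →
  ∀ x y → S x → S y → x ≢ y → (p x ≡ p y → adj G x y ≡ false) × (p x ≢ p y → adj G x y ≡ true)

IsUnionOfCliques : {n : ℕ} → Graph n → VSet n → Set
IsUnionOfCliques {n} G S = Σ (Fin n → ℕ) λ p →
  ∀ x y → S x → S y → x ≢ y → (p x ≡ p y → adj G x y ≡ true) × (p x ≢ p y → adj G x y ≡ false)

{-# OPTIONS --safe #-}
module Submission where

-- For a maximum clique C of ⟨W⟩, every vertex of C ∪ ⋃ I_k misses exactly one vertex of C,
-- and grouping by that vertex gives the parts. Two vertices missing the same k are non-adjacent,
-- since otherwise they could replace k in C; once |C| ≥ 4, two vertices missing different vertices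
-- are adjacent, since otherwise they, one missed vertex and two further vertices of C induce the
-- complement of P₃ ∪ 2K₁. Maximality gives every vertex outside C ∪ ⋃ I_k two non-neighbours in C,
-- and then the same forbidden complement leaves it at most one neighbour in C. Hence, as |A| ≥ 4,
-- any induced P₃ ∪ K₁ in ⟨V₂⟩ extends by two vertices of A to an induced P₃ ∪ 2K₁, so there is
-- none. Since every vertex of X₃ likewise has two non-neighbours and at most one neighbour in A′,
-- this rules out an induced P₃ in ⟨X₃⟩, so ⟨X₃⟩ is a disjoint union of cliques.

open import Defs
open import Data.Nat using (ℕ; zero; suc; _≤_; _<_; s≤s; s≤s⁻¹; z≤n)
open import Data.Nat.Properties using (≤-trans; ≤-reflexive; n≤1+n; <⇒≱; module ≤-Reasoning)
open import Data.Bool using (Bool; true; false; not)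
open import Data.Bool.Properties using (¬-not; not-involutive) renaming (_≟_ to _≟ᵇ_)
open import Data.Fin using (Fin; zero; suc; _≟_; toℕ)
open import Data.Fin.Patterns using (0F; 1F; 2F; 3F; 4F)
open import Data.Fin.Properties using (toℕ-injective; any?; all?)
open import Data.Fin.Subset using (Subset; _∈_; _∉_; _⊆_; ∣_∣; _∪_; _-_; ⁅_⁆; inside; outside; Nonempty)
open import Data.Fin.Subset.Properties
  using (_∈?_; ⊆-refl; p⊆p∪q; x∈p∪q⁻; x∈p∪q⁺; x∈⁅x⁆; x∈⁅y⁆⇒x≡y; p─q⊆p; p─⊥≡p; drop-there; p⊂q⇒∣p∣<∣q∣)
open import Data.Vec using (_∷_; []; lookup; here; there)
open import Data.Vec.Relation.Unary.All using (_∷_; [])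
open import Data.Vec.Relation.Unary.AllPairs using (_∷_; [])
open import Data.Vec.Relation.Unary.Unique.Propositional using (Unique)
open import Data.Vec.Relation.Unary.Unique.Propositional.Properties using (lookup-injective)
open import Data.Product using (Σ-syntax; ∃; _×_; _,_; proj₁; proj₂)
import Data.Product as Product
open import Data.Sum using (_⊎_; inj₁; inj₂)
import Data.Sum as Sum
open import Data.Unit using (tt)
open import Data.Empty using (⊥; ⊥-elim)
open import Function using (_∘_)
open import Level using (0ℓ)
open import Relation.Binary using (Rel; IsPartialEquivalence)
open import Relation.Nullary using (¬_; Dec; yes; no; contradiction)
open import Relation.Nullary.Decidable using (_×-dec_; _⊎-dec_; _→-dec_; ¬?)
open import Relation.Unary using (Pred; Decidable)
open import Relation.Binary.PropositionalEquality as ≡ using (_≡_; _≢_; refl; cong; ≢-sym)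

first : ∀ {m p} {P : Pred (Fin m) p} → Decidable P → ℕ
first {zero} P? = zero
first {suc m} P? with P? zero
... | yes _ = zero
... | no _ = suc (first (P? ∘ suc))

first-witness : ∀ {m p} {P : Pred (Fin m) p} (P? : Decidable P) {z} → P z →
  ∃ λ z′ → first P? ≡ toℕ z′ × P z′
first-witness {suc m} P? {z} Pz with P? zero
first-witness {suc m} P? {z} Pz | yes P0 = zero , refl , P0
first-witness {suc m} P? {zero} Pz | no ¬P0 = contradiction Pz ¬P0
first-witness {suc m} P? {suc z} Pz | no _ with first-witness (P? ∘ suc) Pz
... | z′ , first≡z′ , Pz′ = suc z′ , cong suc first≡z′ , Pz′

first-cong : ∀ {m p q} {P : Pred (Fin m) p} {Q : Pred (Fin m) q} (P? : Decidable P) (Q? : Decidable Q) →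
  (∀ {z} → P z → Q z) → (∀ {z} → Q z → P z) → first P? ≡ first Q?
first-cong {zero} _ _ _ _ = refl
first-cong {suc m} P? Q? P⇒Q Q⇒P with P? zero | Q? zero
... | yes _ | yes _ = refl
... | yes P0 | no ¬Q0 = contradiction (P⇒Q P0) ¬Q0
... | no ¬P0 | yes Q0 = contradiction (Q⇒P Q0) ¬P0
... | no _ | no _ = cong suc (first-cong (P? ∘ suc) (Q? ∘ suc) P⇒Q Q⇒P)

module _ {n : ℕ} {R : Rel (Fin n) 0ℓ} (R? : ∀ x y → Dec (R x y)) (isPER : IsPartialEquivalence R) where
  open IsPartialEquivalence isPER renaming (sym to R-sym; trans to R-trans)

  classIndex : Fin n → ℕ
  classIndex x = first (R? x)

  related⇒classIndex≡ : ∀ {x y} → R x y → classIndex x ≡ classIndex y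
  related⇒classIndex≡ xRy = first-cong (R? _) (R? _) (R-trans (R-sym xRy)) (R-trans xRy)

  classIndex≡⇒related : ∀ {x y} → R x x → R y y → classIndex x ≡ classIndex y → R x y
  classIndex≡⇒related xRx yRy eq with first-witness (R? _) xRx | first-witness (R? _) yRy
  ... | z , ix≡z , xRz | z′ , iy≡z′ , yRz′ with toℕ-injective (≡.trans (≡.sym ix≡z) (≡.trans eq iy≡z′))
  ... | refl = R-trans xRz (R-sym yRz′)

x∈p⇒∣p∣≡suc∣p-x∣ : ∀ {n} {p : Subset n} {x} → x ∈ p → ∣ p ∣ ≡ suc ∣ p - x ∣
x∈p⇒∣p∣≡suc∣p-x∣ {p = inside ∷ p} here = cong suc (cong ∣_∣ (≡.sym (p─⊥≡p p)))
x∈p⇒∣p∣≡suc∣p-x∣ {p = inside ∷ p} (there x∈p) = cong suc (x∈p⇒∣p∣≡suc∣p-x∣ x∈p)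
x∈p⇒∣p∣≡suc∣p-x∣ {p = outside ∷ p} (there x∈p) = x∈p⇒∣p∣≡suc∣p-x∣ x∈p

x∈p-y⇒x≢y : ∀ {n} {p : Subset n} {x y} → x ∈ p - y → x ≢ y
x∈p-y⇒x≢y {p = s ∷ p} {zero} () refl
x∈p-y⇒x≢y {p = s ∷ p} {suc x} x∈p-x refl = x∈p-y⇒x≢y (drop-there x∈p-x) refl

x∈p∪⁅y⁆⇒x∈p⊎x≡y : ∀ {n} {p : Subset n} {x y} → x ∈ p ∪ ⁅ y ⁆ → x ∈ p ⊎ x ≡ y
x∈p∪⁅y⁆⇒x∈p⊎x≡y {p = p} {y = y} = Sum.map₂ (x∈⁅y⁆⇒x≡y y) ∘ x∈p∪q⁻ p ⁅ y ⁆

x∉p⇒∣p∣<∣p∪⁅x⁆∣ : ∀ {n} {p : Subset n} {x} → x ∉ p → ∣ p ∣ < ∣ p ∪ ⁅ x ⁆ ∣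
x∉p⇒∣p∣<∣p∪⁅x⁆∣ {x = x} x∉p = p⊂q⇒∣p∣<∣q∣ (p⊆p∪q ⁅ x ⁆ , x , x∈p∪q⁺ (inj₂ (x∈⁅x⁆ x)) , x∉p)

x∉p∧y∈p⇒x≢y : ∀ {n} {p : Subset n} {x y} → x ∉ p → y ∈ p → x ≢ y
x∉p∧y∈p⇒x≢y x∉p y∈p refl = x∉p y∈p

∣p∣>0⇒Nonempty : ∀ {n} (p : Subset n) → 0 < ∣ p ∣ → Nonempty p
∣p∣>0⇒Nonempty (inside ∷ p) _ = zero , here
∣p∣>0⇒Nonempty (outside ∷ p) 0<∣p∣ = Product.map suc there (∣p∣>0⇒Nonempty p 0<∣p∣)

record DistinctPair {n : ℕ} (P : Fin n → Set) : Set where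
  field
    x y : Fin n
    x≢y : x ≢ y
    Px : P x
    Py : P y

mapDistinctPair : ∀ {n} {P Q : Fin n → Set} → (∀ {z} → P z → Q z) → DistinctPair P → DistinctPair Q
mapDistinctPair P⇒Q pair = record { x = x ; y = y ; x≢y = x≢y ; Px = P⇒Q Px ; Py = P⇒Q Py }
  where open DistinctPair pair

∣p∣≥2⇒DistinctPair : ∀ {n} {p : Subset n} → 2 ≤ ∣ p ∣ → DistinctPair (_∈ p)
∣p∣≥2⇒DistinctPair {p = p} 2≤∣p∣ with ∣p∣>0⇒Nonempty p (≤-trans (s≤s z≤n) 2≤∣p∣)
... | x , x∈p with ∣p∣>0⇒Nonempty (p - x) (s≤s⁻¹ (≤-trans 2≤∣p∣ (≤-reflexive (x∈p⇒∣p∣≡suc∣p-x∣ x∈p))))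
... | y , y∈p-x =
  record { x = x ; y = y ; x≢y = ≢-sym (x∈p-y⇒x≢y y∈p-x) ; Px = x∈p ; Py = p─q⊆p p ⁅ x ⁆ y∈p-x }

AtMostOneIn : ∀ {n} → Subset n → Pred (Fin n) 0ℓ → Set
AtMostOneIn C P = ∀ {x y} → x ∈ C → y ∈ C → P x → P y → x ≡ y

removeAtMostOne : ∀ {n} {C : Subset n} {P : Pred (Fin n) 0ℓ} → Decidable P → AtMostOneIn C P →
  Σ[ D ∈ Subset n ] D ⊆ C × ∣ C ∣ ≤ suc ∣ D ∣ × (∀ {x} → x ∈ D → ¬ P x)
removeAtMostOne {C = C} P? atMostOne with any? (λ x → x ∈? C ×-dec P? x)
... | yes (p , p∈C , Pp) =
  C - p , p─q⊆p C ⁅ p ⁆ , ≤-reflexive (x∈p⇒∣p∣≡suc∣p-x∣ p∈C) ,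
  λ x∈C-p Px → x∈p-y⇒x≢y x∈C-p (atMostOne (p─q⊆p C ⁅ p ⁆ x∈C-p) p∈C Px Pp)
... | no none = C , ⊆-refl , n≤1+n _ , λ x∈C Px → none (_ , x∈C , Px)

pairAvoiding : ∀ {n} {C : Subset n} {P Q : Pred (Fin n) 0ℓ} → Decidable P → Decidable Q →
  AtMostOneIn C P → AtMostOneIn C Q → 4 ≤ ∣ C ∣ → DistinctPair (λ x → x ∈ C × ¬ P x × ¬ Q x)
pairAvoiding P? Q? atMostOneP atMostOneQ 4≤∣C∣ with removeAtMostOne P? atMostOneP
... | D , D⊆C , ∣C∣≤1+∣D∣ , ¬P
  with removeAtMostOne Q? (λ x∈D y∈D → atMostOneQ (D⊆C x∈D) (D⊆C y∈D))
... | E , E⊆D , ∣D∣≤1+∣E∣ , ¬Q =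
  mapDistinctPair (λ z∈E → D⊆C (E⊆D z∈E) , ¬P (E⊆D z∈E) , ¬Q z∈E) (∣p∣≥2⇒DistinctPair 2≤∣E∣)
  where
  2≤∣E∣ : 2 ≤ ∣ E ∣
  2≤∣E∣ = s≤s⁻¹ (s≤s⁻¹ (≤-trans 4≤∣C∣ (≤-trans ∣C∣≤1+∣D∣ (s≤s ∣D∣≤1+∣E∣))))

module Adjacency {n : ℕ} (G : Graph n) where
  infix 4 _∼_ _≁_

  _∼_ _≁_ : Fin n → Fin n → Set
  x ∼ y = adj G x y ≡ true
  x ≁ y = adj G x y ≡ false

  adj-sym : ∀ {x y b} → adj G x y ≡ b → adj G y x ≡ b
  adj-sym {x} {y} xy≡b = ≡.trans (sym G y x) xy≡b

  ∼⇒≢ : ∀ {x y} → x ∼ y → x ≢ y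
  ∼⇒≢ {x} x∼x refl with ≡.trans (≡.sym x∼x) (irrefl G x)
  ... | ()

  ∼≁⇒≢ : ∀ {x y z} → x ∼ z → y ≁ z → x ≢ y
  ∼≁⇒≢ x∼z x≁z refl with ≡.trans (≡.sym x∼z) x≁z
  ... | ()

complement : ∀ {n} → Graph n → Graph n
complement G = record { adj = complementAdj (adj G) ; sym = symmetric ; irrefl = irreflexive }
  where
  symmetric : ∀ i j → complementAdj (adj G) i j ≡ complementAdj (adj G) j i
  symmetric i j with i ≟ j | j ≟ i
  ... | yes _ | yes _ = refl
  ... | yes i≡j | no j≢i = contradiction (≡.sym i≡j) j≢i
  ... | no i≢j | yes j≡i = contradiction (≡.sym j≡i) i≢j
  ... | no _ | no _ = cong not (sym G i j)
  irreflexive : ∀ i → complementAdj (adj G) i i ≡ false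
  irreflexive i with i ≟ i
  ... | yes _ = refl
  ... | no i≢i = contradiction refl i≢i

complement-induced : ∀ {n k} {G : Graph n} {h : Fin k → Fin k → Bool} →
  ContainsInduced (complement G) h → ContainsInduced G (complementAdj h)
complement-induced {G = G} {h} (f , f-injective , f-induced) = f , f-injective , induced
  where
  induced : ∀ i j → adj G (f i) (f j) ≡ complementAdj h i j
  induced i j with i ≟ j | f i ≟ f j | f-induced i j
  ... | yes refl | _ | _ = irrefl G (f i)
  ... | no i≢j | yes fi≡fj | _ = contradiction (f-injective fi≡fj) i≢j
  ... | no _ | no _ | not-fij≡hij = ≡.trans (≡.sym (not-involutive _)) (cong not not-fij≡hij)

module _ {n : ℕ} (G : Graph n) where
  open Adjacency G

  P₃∪2K₁-free : ¬ ContainsInduced G P3∪2K1 → ∀ {x y z u w} →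
    x ∼ y → y ∼ z → x ≁ z → x ≢ z →
    u ≁ x → u ≁ y → u ≁ z → w ≁ x → w ≁ y → w ≁ z → u ≁ w → u ≢ w → ⊥
  P₃∪2K₁-free noP {x} {y} {z} {u} {w} xy yz xz x≢z ux uy uz wx wy wz uw u≢w =
    noP (lookup vertices , (λ {i} {j} → lookup-injective distinct i j) , induced)
    where
    vertices = x ∷ y ∷ z ∷ u ∷ w ∷ []
    distinct : Unique vertices
    distinct =
      (∼⇒≢ xy ∷ x≢z ∷ ∼≁⇒≢ xy uy ∷ ∼≁⇒≢ xy wy ∷ []) ∷
      (∼⇒≢ yz ∷ ∼≁⇒≢ (adj-sym xy) ux ∷ ∼≁⇒≢ (adj-sym xy) wx ∷ []) ∷
      (∼≁⇒≢ (adj-sym yz) uy ∷ ∼≁⇒≢ (adj-sym yz) wy ∷ []) ∷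
      (u≢w ∷ []) ∷ [] ∷ []
    induced : ∀ i j → adj G (lookup vertices i) (lookup vertices j) ≡ P3∪2K1 i j
    induced 0F 0F = irrefl G x
    induced 0F 1F = xy
    induced 0F 2F = xz
    induced 0F 3F = adj-sym ux
    induced 0F 4F = adj-sym wx
    induced 1F 0F = adj-sym xy
    induced 1F 1F = irrefl G y
    induced 1F 2F = yz
    induced 1F 3F = adj-sym uy
    induced 1F 4F = adj-sym wy
    induced 2F 0F = adj-sym xz
    induced 2F 1F = adj-sym yz
    induced 2F 2F = irrefl G z
    induced 2F 3F = adj-sym uz
    induced 2F 4F = adj-sym wz
    induced 3F 0F = ux
    induced 3F 1F = uy
    induced 3F 2F = uz
    induced 3F 3F = irrefl G u
    induced 3F 4F = uw
    induced 4F 0F = wx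
    induced 4F 1F = wy
    induced 4F 2F = wz
    induced 4F 3F = adj-sym uw
    induced 4F 4F = irrefl G w

-- A vertex of C misses only itself, a vertex of I_k only k: the parts of C ∪ ⋃ I_k are
-- indexed by the missed vertex.
MissesOnly : ∀ {n} → Graph n → Subset n → Fin n → Fin n → Set
MissesOnly G C x k = k ∈ C × adj G x k ≡ false × (∀ i → i ∈ C → i ≢ k → adj G x i ≡ true)

SameNeighboursIn : ∀ {n} → Graph n → Subset n → Rel (Fin n) 0ℓ
SameNeighboursIn G C x y = ∀ i → i ∈ C → adj G x i ≡ adj G y i

module _ {n : ℕ} (G : Graph n) where
  open Adjacency G

  co-P₃∪2K₁-free : ¬ ContainsInduced G (complementAdj P3∪2K1) → ∀ {x y z u w} →
    y ≁ x → y ≁ z → x ∼ z → u ∼ x → u ∼ y → u ∼ z → w ∼ x → w ∼ y → w ∼ z → u ∼ w → ⊥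
  co-P₃∪2K₁-free noC yx yz xz ux uy uz wx wy wz uw =
    P₃∪2K₁-free (complement G) (noC ∘ complement-induced {G = G})
      (co∼ (∼≁⇒≢ xz yz) (adj-sym yx)) (co∼ (≢-sym (∼≁⇒≢ (adj-sym xz) yx)) yz) (co≁ xz) (∼⇒≢ xz)
      (co≁ ux) (co≁ uy) (co≁ uz) (co≁ wx) (co≁ wy) (co≁ wz) (co≁ uw) (∼⇒≢ uw)
    where
    co∼ : ∀ {a b} → a ≢ b → a ≁ b → adj (complement G) a b ≡ true
    co∼ {a} {b} a≢b a≁b with a ≟ b
    ... | yes a≡b = contradiction a≡b a≢b
    ... | no _ = cong not a≁b
    co≁ : ∀ {a b} → a ∼ b → adj (complement G) a b ≡ false
    co≁ {a} {b} a∼b with a ≟ b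
    ... | yes _ = refl
    ... | no _ = cong not a∼b

  clique-∪⁅⁆ : ∀ {T x} → IsClique G T → (∀ i → i ∈ T → i ≢ x → x ∼ i) → IsClique G (T ∪ ⁅ x ⁆)
  clique-∪⁅⁆ T-clique x∼T i j i∈ j∈ i≢j with x∈p∪⁅y⁆⇒x∈p⊎x≡y i∈ | x∈p∪⁅y⁆⇒x∈p⊎x≡y j∈
  ... | inj₁ i∈T | inj₁ j∈T = T-clique i j i∈T j∈T i≢j
  ... | inj₁ i∈T | inj₂ refl = adj-sym (x∼T i i∈T i≢j)
  ... | inj₂ refl | inj₁ j∈T = x∼T j j∈T (≢-sym i≢j)
  ... | inj₂ refl | inj₂ refl = contradiction refl i≢j

  missedVertex : ∀ {W C x} → IsClique G C → Xpart G W C x → ∃ (MissesOnly G C x)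
  missedVertex C-clique (inj₁ x∈C) = _ , x∈C , irrefl G _ , λ i i∈C i≢x → C-clique _ i x∈C i∈C (≢-sym i≢x)
  missedVertex C-clique (inj₂ (k , k∈C , _ , _ , x≁k , x∼C-k)) = k , k∈C , x≁k , x∼C-k

  sameMissed⇒sameNeighbours : ∀ {C x y k j} → MissesOnly G C x k → MissesOnly G C y j → k ≡ j →
    SameNeighboursIn G C x y
  sameMissed⇒sameNeighbours {k = k} (_ , x≁k , x∼C-k) (_ , y≁k , y∼C-k) refl i i∈C with i ≟ k
  ... | yes refl = ≡.trans x≁k (≡.sym y≁k)
  ... | no i≢k = ≡.trans (x∼C-k i i∈C i≢k) (≡.sym (y∼C-k i i∈C i≢k))

  sameNeighbours⇒sameMissed : ∀ {C x y k j} → MissesOnly G C x k → MissesOnly G C y j →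
    SameNeighboursIn G C x y → k ≡ j
  sameNeighbours⇒sameMissed {k = k} {j} (k∈C , x≁k , _) (_ , _ , y∼C-j) same with k ≟ j
  ... | yes k≡j = k≡j
  ... | no k≢j = contradiction refl (∼≁⇒≢ (y∼C-j k k∈C k≢j) (≡.trans (≡.sym (same k k∈C)) x≁k))

  sameNeighbours? : ∀ C x y → Dec (SameNeighboursIn G C x y)
  sameNeighbours? C x y = all? (λ i → (i ∈? C) →-dec (adj G x i ≟ᵇ adj G y i))

  sameNeighbours-isPER : ∀ C → IsPartialEquivalence (SameNeighboursIn G C)
  sameNeighbours-isPER C = record
    { sym = λ same i i∈C → ≡.sym (same i i∈C)
    ; trans = λ same same′ i i∈C → ≡.trans (same i i∈C) (same′ i i∈C)
    }

  module _ (noC : ¬ ContainsInduced G (complementAdj P3∪2K1)) {C : Subset n} (C-clique : IsClique G C) where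

    twoNonNeighbours⇒atMostOneNeighbour : ∀ {v} → DistinctPair (λ i → i ∈ C × v ≁ i) → AtMostOneIn C (v ∼_)
    twoNonNeighbours⇒atMostOneNeighbour {v} pair {r} {s} r∈C s∈C v∼r v∼s with r ≟ s
    ... | yes r≡s = r≡s
    ... | no r≢s =
      ⊥-elim (co-P₃∪2K₁-free noC v≁p v≁q (C-clique p q p∈C q∈C p≢q)
        (r∼ p∈C v≁p) (adj-sym v∼r) (r∼ q∈C v≁q)
        (s∼ p∈C v≁p) (adj-sym v∼s) (s∼ q∈C v≁q)
        (C-clique r s r∈C s∈C r≢s))
      where
      open DistinctPair pair renaming (x to p; y to q; x≢y to p≢q)
      p∈C = proj₁ Px
      v≁p = proj₂ Px
      q∈C = proj₁ Py
      v≁q = proj₂ Py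
      r∼ : ∀ {t} → t ∈ C → v ≁ t → r ∼ t
      r∼ t∈C v≁t = C-clique _ _ r∈C t∈C (∼≁⇒≢ (adj-sym v∼r) (adj-sym v≁t))
      s∼ : ∀ {t} → t ∈ C → v ≁ t → s ∼ t
      s∼ t∈C v≁t = C-clique _ _ s∈C t∈C (∼≁⇒≢ (adj-sym v∼s) (adj-sym v≁t))

    differentMissed⇒adjacent : 4 ≤ ∣ C ∣ → ∀ {x y k j} → MissesOnly G C x k → MissesOnly G C y j → k ≢ j → x ∼ y
    differentMissed⇒adjacent 4≤∣C∣ {k = k} {j} (k∈C , x≁k , x∼C-k) (_ , _ , y∼C-j) k≢j =
      ¬-not λ x≁y → co-P₃∪2K₁-free noC x≁y x≁k (y∼C-j k k∈C k≢j)
        (adj-sym (y∼C-j d d∈C d≢j)) (adj-sym (x∼C-k d d∈C d≢k)) (C-clique d k d∈C k∈C d≢k)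
        (adj-sym (y∼C-j e e∈C e≢j)) (adj-sym (x∼C-k e e∈C e≢k)) (C-clique e k e∈C k∈C e≢k)
        (C-clique d e d∈C e∈C d≢e)
      where
      open DistinctPair (pairAvoiding {C = C} (_≟ k) (_≟ j) (λ _ _ d≡k e≡k → ≡.trans d≡k (≡.sym e≡k))
                                                              (λ _ _ d≡j e≡j → ≡.trans d≡j (≡.sym e≡j)) 4≤∣C∣)
        renaming (x to d; y to e; x≢y to d≢e)
      d∈C = proj₁ Px
      d≢k = proj₁ (proj₂ Px)
      d≢j = proj₂ (proj₂ Px)
      e∈C = proj₁ Py
      e≢k = proj₁ (proj₂ Py)
      e≢j = proj₂ (proj₂ Py)

  -- Adjacency-or-equality is an equivalence relation on S; its classes are the cliques.
  P₃-free⇒unionOfCliques : (S : VSet n) → Decidable S →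
    (∀ {x y z} → S x → S y → S z → x ∼ y → y ∼ z → x ≢ z → x ∼ z) → IsUnionOfCliques G S
  P₃-free⇒unionOfCliques S S? P₃-free =
    classIndex R? isPER , λ x y Sx Sy x≢y →
      (λ same → adjacent-or-equal x≢y (classIndex≡⇒related R? isPER (reflexive Sx) (reflexive Sy) same)) ,
      (λ different → ¬-not λ x∼y → different (related⇒classIndex≡ R? isPER (Sx , Sy , inj₂ x∼y)))
    where
    R : Rel (Fin n) 0ℓ
    R x y = S x × S y × (x ≡ y ⊎ x ∼ y)
    R? : ∀ x y → Dec (R x y)
    R? x y = S? x ×-dec S? y ×-dec (x ≟ y ⊎-dec (adj G x y ≟ᵇ true))
    reflexive : ∀ {x} → S x → R x x
    reflexive Sx = Sx , Sx , inj₁ refl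
    adjacent-or-equal : ∀ {x y} → x ≢ y → R x y → x ∼ y
    adjacent-or-equal x≢y (_ , _ , inj₁ x≡y) = contradiction x≡y x≢y
    adjacent-or-equal x≢y (_ , _ , inj₂ x∼y) = x∼y
    isPER : IsPartialEquivalence R
    isPER = record { sym = R-sym ; trans = R-trans }
      where
      R-sym : ∀ {x y} → R x y → R y x
      R-sym (Sx , Sy , inj₁ refl) = Sy , Sx , inj₁ refl
      R-sym (Sx , Sy , inj₂ x∼y) = Sy , Sx , inj₂ (adj-sym x∼y)
      R-trans : ∀ {x y z} → R x y → R y z → R x z
      R-trans (Sx , _ , inj₁ refl) yRz = yRz
      R-trans xRy (_ , Sz , inj₁ refl) = xRy
      R-trans {x} {y} {z} (Sx , Sy , inj₂ x∼y) (_ , Sz , inj₂ y∼z) with x ≟ z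
      ... | yes x≡z = Sx , Sz , inj₁ x≡z
      ... | no x≢z = Sx , Sz , inj₂ (P₃-free Sx Sy Sz x∼y y∼z x≢z)

  Xpart? : ∀ {W} → Decidable W → ∀ C → Decidable (Xpart G W C)
  Xpart? {W} W? C v = (v ∈? C) ⊎-dec any? (λ k → (k ∈? C) ×-dec Ipart? k)
    where
    Ipart? : ∀ k → Dec (Ipart G W C k v)
    Ipart? k = W? v ×-dec ¬? (v ∈? C) ×-dec (adj G v k ≟ᵇ false) ×-dec
               all? (λ i → (i ∈? C) →-dec (¬? (i ≟ k) →-dec (adj G v i ≟ᵇ true)))

module MaxClique {n : ℕ} (G : Graph n) (W : VSet n) (C : Subset n) (maxC : IsMaxCliqueIn G W C) where
  open Adjacency G

  C⊆W : C ⊆ₚ W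
  C⊆W = proj₁ maxC

  isClique : IsClique G C
  isClique = proj₁ (proj₂ maxC)

  no-larger-clique : ∀ {T} → T ⊆ₚ W → IsClique G T → ∣ C ∣ < ∣ T ∣ → ⊥
  no-larger-clique T⊆W T-clique ∣C∣<∣T∣ = <⇒≱ ∣C∣<∣T∣ (proj₂ (proj₂ maxC) _ T⊆W T-clique)

  ∪⁅⁆⊆W : ∀ {T x} → T ⊆ₚ W → W x → (T ∪ ⁅ x ⁆) ⊆ₚ W
  ∪⁅⁆⊆W T⊆W Wx i i∈ with x∈p∪⁅y⁆⇒x∈p⊎x≡y i∈
  ... | inj₁ i∈T = T⊆W i i∈T
  ... | inj₂ refl = Wx

  no-dominating-vertex : ∀ {u} → W u → (∀ i → i ∈ C → u ∼ i) → ⊥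
  no-dominating-vertex {u} Wu u∼C =
    no-larger-clique (∪⁅⁆⊆W C⊆W Wu) (clique-∪⁅⁆ G isClique (λ i i∈C _ → u∼C i i∈C))
      (x∉p⇒∣p∣<∣p∪⁅x⁆∣ λ u∈C → ∼⇒≢ (u∼C u u∈C) refl)

  -- Otherwise (C - k) ∪ {x, y} would be a larger clique.
  sameMissed⇒nonadjacent : ∀ {x y k} → W x → W y → x ≢ y → MissesOnly G C x k → MissesOnly G C y k → x ≁ y
  sameMissed⇒nonadjacent {x} {y} {k} Wx Wy x≢y x-misses@(k∈C , x≁k , x∼C-k) y-misses@(_ , y≁k , y∼C-k)
    with x ≟ k | y ≟ k
  ... | yes refl | _ = adj-sym y≁k
  ... | _ | yes refl = x≁k
  ... | no x≢k | no y≢k = ¬-not λ x∼y →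
    no-larger-clique (∪⁅⁆⊆W (∪⁅⁆⊆W C-k⊆W Wx) Wy)
      (clique-∪⁅⁆ G (clique-∪⁅⁆ G C-k-clique x∼C-k′) (y∼T₁ x∼y)) ∣C∣<∣T₂∣
    where
    open ≤-Reasoning
    T₀ T₁ T₂ : Subset n
    T₀ = C - k
    T₁ = T₀ ∪ ⁅ x ⁆
    T₂ = T₁ ∪ ⁅ y ⁆
    C-k⊆W : T₀ ⊆ₚ W
    C-k⊆W i i∈ = C⊆W i (p─q⊆p C ⁅ k ⁆ i∈)
    C-k-clique : IsClique G T₀
    C-k-clique i j i∈ j∈ = isClique i j (p─q⊆p C ⁅ k ⁆ i∈) (p─q⊆p C ⁅ k ⁆ j∈)
    x∼C-k′ : ∀ i → i ∈ T₀ → i ≢ x → x ∼ i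
    x∼C-k′ i i∈ _ = x∼C-k i (p─q⊆p C ⁅ k ⁆ i∈) (x∈p-y⇒x≢y i∈)
    y∼T₁ : x ∼ y → ∀ i → i ∈ T₁ → i ≢ y → y ∼ i
    y∼T₁ x∼y i i∈ _ with x∈p∪⁅y⁆⇒x∈p⊎x≡y i∈
    ... | inj₁ i∈T₀ = y∼C-k i (p─q⊆p C ⁅ k ⁆ i∈T₀) (x∈p-y⇒x≢y i∈T₀)
    ... | inj₂ refl = adj-sym x∼y
    ∉T₀ : ∀ {v} → MissesOnly G C v k → v ≢ k → v ∉ T₀
    ∉T₀ {v} (_ , _ , v∼C-k) v≢k v∈T₀ = ∼⇒≢ (v∼C-k v (p─q⊆p C ⁅ k ⁆ v∈T₀) v≢k) refl
    y∉T₁ : y ∉ T₁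
    y∉T₁ y∈T₁ with x∈p∪⁅y⁆⇒x∈p⊎x≡y y∈T₁
    ... | inj₁ y∈T₀ = ∉T₀ y-misses y≢k y∈T₀
    ... | inj₂ y≡x = x≢y (≡.sym y≡x)
    ∣C∣<∣T₂∣ : ∣ C ∣ < ∣ T₂ ∣
    ∣C∣<∣T₂∣ = begin-strict
      ∣ C ∣        ≡⟨ x∈p⇒∣p∣≡suc∣p-x∣ k∈C ⟩
      suc ∣ T₀ ∣   ≤⟨ x∉p⇒∣p∣<∣p∪⁅x⁆∣ (∉T₀ x-misses x≢k) ⟩
      ∣ T₁ ∣       <⟨ x∉p⇒∣p∣<∣p∪⁅x⁆∣ y∉T₁ ⟩
      ∣ T₂ ∣       ∎

  twoNonNeighbours : ∀ {v} → W v → ¬ Xpart G W C v → DistinctPair (λ i → i ∈ C × v ≁ i)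
  twoNonNeighbours {v} Wv v∉X with any? (λ p → (p ∈? C) ×-dec (adj G v p ≟ᵇ false))
  ... | no none = ⊥-elim (no-dominating-vertex Wv λ i i∈C → ¬-not λ v≁i → none (i , i∈C , v≁i))
  ... | yes (p , p∈C , v≁p) with any? (λ q → (q ∈? C) ×-dec ¬? (q ≟ p) ×-dec (adj G v q ≟ᵇ false))
  ...   | yes (q , q∈C , q≢p , v≁q) =
    record { x = p ; y = q ; x≢y = ≢-sym q≢p ; Px = p∈C , v≁p ; Py = q∈C , v≁q }
  ...   | no none = ⊥-elim (v∉X (inj₂ (p , p∈C , v∈I-p)))
    where
    v∈I-p : Ipart G W C p v
    v∈I-p = Wv , (λ v∈C → v∉X (inj₁ v∈C)) , v≁p , λ i i∈C i≢p → ¬-not λ v≁i → none (i , i∈C , i≢p , v≁i)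

  Xpart⊆W : ∀ {x} → Xpart G W C x → W x
  Xpart⊆W (inj₁ x∈C) = C⊆W _ x∈C
  Xpart⊆W (inj₂ (_ , _ , Wx , _)) = Wx

  missed : ∀ {x} → Xpart G W C x → ∃ (MissesOnly G C x)
  missed = missedVertex G {W = W} isClique

  neighbourClass : Fin n → ℕ
  neighbourClass = classIndex (sameNeighbours? G C) (sameNeighbours-isPER G C)

  sameClass⇒nonadjacent : ∀ {x y} → Xpart G W C x → Xpart G W C y → x ≢ y →
    neighbourClass x ≡ neighbourClass y → x ≁ y
  sameClass⇒nonadjacent hx hy x≢y same with missed hx | missed hy
  ... | k , x-misses | j , y-misses
    with sameNeighbours⇒sameMissed G x-misses y-misses
           (classIndex≡⇒related (sameNeighbours? G C) (sameNeighbours-isPER G C)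
             (λ _ _ → refl) (λ _ _ → refl) same)
  ... | refl = sameMissed⇒nonadjacent (Xpart⊆W hx) (Xpart⊆W hy) x≢y x-misses y-misses

  differentClass⇒adjacent : ¬ ContainsInduced G (complementAdj P3∪2K1) → 4 ≤ ∣ C ∣ →
    ∀ {x y} → Xpart G W C x → Xpart G W C y → neighbourClass x ≢ neighbourClass y → x ∼ y
  differentClass⇒adjacent noC 4≤∣C∣ hx hy different with missed hx | missed hy
  ... | k , x-misses | j , y-misses =
    differentMissed⇒adjacent G noC isClique 4≤∣C∣ x-misses y-misses λ k≡j →
      different (related⇒classIndex≡ (sameNeighbours? G C) (sameNeighbours-isPER G C)
                  (sameMissed⇒sameNeighbours G x-misses y-misses k≡j))

  Xpart-multipartite : IsMultipartite G (Xpart G W C)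
  Xpart-multipartite = neighbourClass , λ _ _ hx hy x≢y → sameClass⇒nonadjacent hx hy x≢y

  Xpart-completeMultipartite : ¬ ContainsInduced G (complementAdj P3∪2K1) → 4 ≤ ∣ C ∣ →
    IsCompleteMultipartite G (Xpart G W C)
  Xpart-completeMultipartite noC 4≤∣C∣ =
    neighbourClass , λ _ _ hx hy x≢y →
      sameClass⇒nonadjacent hx hy x≢y , differentClass⇒adjacent noC 4≤∣C∣ hx hy

module Decomposition {n : ℕ} (G : Graph n)
  (noP : ¬ ContainsInduced G P3∪2K1) (noC : ¬ ContainsInduced G (complementAdj P3∪2K1))
  (A : Subset n) (maxA : IsMaxCliqueIn G Everything A) (4≤∣A∣ : 4 ≤ ∣ A ∣)
  (A′ : Subset n) (maxA′ : IsMaxCliqueIn G (V₂ G A) A′) where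

  open Adjacency G
  private
    module A = MaxClique G Everything A maxA
    module A′ = MaxClique G (V₂ G A) A′ maxA′

  X₁? : Decidable (X₁ G A)
  X₁? = Xpart? G (λ _ → yes tt) A

  X₂? : Decidable (X₂ G A A′)
  X₂? = Xpart? G (¬? ∘ X₁?) A′

  X₃? : Decidable (X₃ G A A′)
  X₃? v = ¬? (X₁? v) ×-dec ¬? (X₂? v)

  cover : ∀ v → X₁ G A v ⊎ X₂ G A A′ v ⊎ X₃ G A A′ v
  cover v with X₁? v | X₂? v
  ... | yes v∈X₁ | _ = inj₁ v∈X₁
  ... | no _ | yes v∈X₂ = inj₂ (inj₁ v∈X₂)
  ... | no v∉X₁ | no v∉X₂ = inj₂ (inj₂ (v∉X₁ , v∉X₂))

  V₂⇒∉A : ∀ {v} → V₂ G A v → v ∉ A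
  V₂⇒∉A v∈V₂ v∈A = v∈V₂ (inj₁ v∈A)

  X₃⇒∉A′ : ∀ {v} → X₃ G A A′ v → v ∉ A′
  X₃⇒∉A′ (_ , v∉X₂) v∈A′ = v∉X₂ (inj₁ v∈A′)

  A′⊆V₂ : ∀ {v} → v ∈ A′ → V₂ G A v
  A′⊆V₂ = A′.C⊆W _

  V₂-atMostOneNeighbourInA : ∀ {v} → V₂ G A v → AtMostOneIn A (v ∼_)
  V₂-atMostOneNeighbourInA v∈V₂ =
    twoNonNeighbours⇒atMostOneNeighbour G noC A.isClique (A.twoNonNeighbours tt v∈V₂)

  X₃-twoNonNeighboursInA′ : ∀ {v} → X₃ G A A′ v → DistinctPair (λ i → i ∈ A′ × v ≁ i)
  X₃-twoNonNeighboursInA′ (v∈V₂ , v∉X₂) = A′.twoNonNeighbours v∈V₂ v∉X₂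

  X₃-atMostOneNeighbourInA′ : ∀ {v} → X₃ G A A′ v → AtMostOneIn A′ (v ∼_)
  X₃-atMostOneNeighbourInA′ v∈X₃ =
    twoNonNeighbours⇒atMostOneNeighbour G noC A′.isClique (X₃-twoNonNeighboursInA′ v∈X₃)

  V₂-commonNonNeighboursInA : ∀ {u v} → V₂ G A u → V₂ G A v → DistinctPair (λ i → i ∈ A × u ≁ i × v ≁ i)
  V₂-commonNonNeighboursInA {u} {v} u∈V₂ v∈V₂ =
    mapDistinctPair (Product.map₂ (Product.map ¬-not ¬-not))
      (pairAvoiding (λ i → adj G u i ≟ᵇ true) (λ i → adj G v i ≟ᵇ true)
        (V₂-atMostOneNeighbourInA u∈V₂) (V₂-atMostOneNeighbourInA v∈V₂) 4≤∣A∣)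

  -- Two vertices of A missed by a and c turn such a configuration into an induced P₃ ∪ 2K₁.
  V₂-P₃∪K₁-free : ∀ {a b c w} → V₂ G A a → V₂ G A b → V₂ G A c → V₂ G A w →
    a ∼ b → b ∼ c → a ≁ c → a ≢ c → w ≁ a → w ≁ b → w ≁ c → ⊥
  V₂-P₃∪K₁-free {a} {b} {c} {w} a∈V₂ b∈V₂ c∈V₂ w∈V₂ ab bc ac a≢c wa wb wc =
    x≢y (V₂-atMostOneNeighbourInA b∈V₂ x∈A y∈A (b∼ x∈A ax cx (w≁ x∈A y∈A x≢y ax cx ay cy))
                                                (b∼ y∈A ay cy (w≁ y∈A x∈A (≢-sym x≢y) ay cy ax cx)))
    where
    open DistinctPair (V₂-commonNonNeighboursInA a∈V₂ c∈V₂)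
    x∈A = proj₁ Px
    ax = proj₁ (proj₂ Px)
    cx = proj₂ (proj₂ Px)
    y∈A = proj₁ Py
    ay = proj₁ (proj₂ Py)
    cy = proj₂ (proj₂ Py)
    w≢ : ∀ {i} → i ∈ A → w ≢ i
    w≢ = x∉p∧y∈p⇒x≢y (V₂⇒∉A w∈V₂)
    w≁ : ∀ {i j} → i ∈ A → j ∈ A → i ≢ j → a ≁ i → c ≁ i → a ≁ j → c ≁ j → w ≁ i
    w≁ {i} {j} i∈A j∈A i≢j ai ci aj cj with adj G w i in wi | adj G w j in wj
    ... | false | _ = refl
    ... | true | true = contradiction (V₂-atMostOneNeighbourInA w∈V₂ i∈A j∈A wi wj) i≢j
    ... | true | false = ⊥-elim (P₃∪2K₁-free G noP wi (A.isClique i j i∈A j∈A i≢j) wj (w≢ j∈A)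
                          (adj-sym wa) ai aj (adj-sym wc) ci cj ac a≢c)
    b∼ : ∀ {i} → i ∈ A → a ≁ i → c ≁ i → w ≁ i → b ∼ i
    b∼ i∈A ai ci wi = ¬-not λ bi → P₃∪2K₁-free G noP ab bc ac a≢c
      (adj-sym ai) (adj-sym bi) (adj-sym ci) wa wb wc (adj-sym wi) (≢-sym (w≢ i∈A))

  -- Otherwise a - w - w′, for a vertex w′ of A′ missed by a and c, is an induced P₃ in ⟨V₂⟩
  -- missed by c.
  X₃-nonadjacent⇒sameNeighboursInA′ : ∀ {a c w} → X₃ G A A′ a → X₃ G A A′ c → a ≁ c →
    w ∈ A′ → a ∼ w → c ∼ w
  X₃-nonadjacent⇒sameNeighboursInA′ {a} {c} {w} a∈X₃ c∈X₃ ac w∈A′ aw = ¬-not λ cw →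
    V₂-P₃∪K₁-free (proj₁ a∈X₃) (A′⊆V₂ w∈A′) (A′⊆V₂ w′∈A′) (proj₁ c∈X₃)
      aw (A′.isClique w w′ w∈A′ w′∈A′ (∼≁⇒≢ (adj-sym aw) (adj-sym aw′))) aw′
      (x∉p∧y∈p⇒x≢y (X₃⇒∉A′ a∈X₃) w′∈A′) (adj-sym ac) cw cw′
    where
    missedByBoth : Σ[ w′ ∈ Fin n ] w′ ∈ A′ × a ≁ w′ × c ≁ w′
    missedByBoth with X₃-twoNonNeighboursInA′ a∈X₃
    ... | record { x = p ; y = q ; x≢y = p≢q ; Px = p∈A′ , ap ; Py = q∈A′ , aq }
      with adj G c p in cp | adj G c q in cq
    ...   | false | _ = p , p∈A′ , ap , cp
    ...   | true | false = q , q∈A′ , aq , cq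
    ...   | true | true = contradiction (X₃-atMostOneNeighbourInA′ c∈X₃ p∈A′ q∈A′ cp cq) p≢q
    w′ = proj₁ missedByBoth
    w′∈A′ = proj₁ (proj₂ missedByBoth)
    aw′ = proj₁ (proj₂ (proj₂ missedByBoth))
    cw′ = proj₂ (proj₂ (proj₂ missedByBoth))

  -- Both non-neighbours of b in A′ would have to be neighbours of a.
  X₃-P₃-free : ∀ {a b c} → X₃ G A A′ a → X₃ G A A′ b → X₃ G A A′ c → a ∼ b → b ∼ c → a ≢ c → a ∼ c
  X₃-P₃-free {a} {b} {c} a∈X₃ b∈X₃ c∈X₃ ab bc a≢c = ¬-not λ ac →
    x≢y (X₃-atMostOneNeighbourInA′ a∈X₃ (proj₁ Px) (proj₁ Py)
          (a∼ ac (proj₁ Px) (proj₂ Px)) (a∼ ac (proj₁ Py) (proj₂ Py)))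
    where
    open DistinctPair (X₃-twoNonNeighboursInA′ b∈X₃)
    a∼ : a ≁ c → ∀ {r} → r ∈ A′ → b ≁ r → a ∼ r
    a∼ ac {r} r∈A′ br with adj G a r in ar | adj G c r in cr
    ... | true | _ = refl
    ... | false | true = ≡.trans (≡.sym ar) (X₃-nonadjacent⇒sameNeighboursInA′ c∈X₃ a∈X₃ (adj-sym ac) r∈A′ cr)
    ... | false | false = ⊥-elim (V₂-P₃∪K₁-free (proj₁ a∈X₃) (proj₁ b∈X₃) (proj₁ c∈X₃) (A′⊆V₂ r∈A′)
                            ab bc ac a≢c (adj-sym ar) (adj-sym br) (adj-sym cr))

theorem3p7 : {n : ℕ} (G : Graph n) →
    ¬ ContainsInduced G P3∪2K1 →
    ¬ ContainsInduced G (complementAdj P3∪2K1) →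
    (A : Subset n) → IsMaxCliqueIn G Everything A → 4 ≤ ∣ A ∣ →
    (A' : Subset n) → IsMaxCliqueIn G (V₂ G A) A' →
    (∀ v → X₁ G A v ⊎ X₂ G A A' v ⊎ X₃ G A A' v)
    × IsCompleteMultipartite G (X₁ G A)
    × IsMultipartite G (X₂ G A A')
    × (4 ≤ ∣ A' ∣ → IsCompleteMultipartite G (X₂ G A A'))
    × IsUnionOfCliques G (X₃ G A A')
theorem3p7 G noP noC A maxA 4≤∣A∣ A' maxA' =
  cover ,
  MaxClique.Xpart-completeMultipartite G Everything A maxA noC 4≤∣A∣ ,
  MaxClique.Xpart-multipartite G (V₂ G A) A' maxA' ,
  MaxClique.Xpart-completeMultipartite G (V₂ G A) A' maxA' noC ,
  P₃-free⇒unionOfCliques G (X₃ G A A') X₃? X₃-P₃-free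
  where open Decomposition G noP noC A maxA 4≤∣A∣ A' maxA'
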